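{- Let $G=(V,E)$ be a simple connected graph with $n=|V|$, and let $\{V_1,V_2,V_3\}$ be a feasible tripartition of $V$ with $|V_1|\le|V_2|\le|V_3|$ and $|V_3|>\frac12 n$. Let $i\in\{1,2\}$ and let $U$ be a non-empty proper subset of $V_3$ such that $G[U]$ and $G[V_3\setminus U]$ are connected, $U$ is adjacent to $V_i$, and $|V_i|+|U|<|V_3|$. Then $\{V_3\setminus U,V_i\cup U,V_{3-i}\}$ is a feasible tripartition of $V$ and it is better than $\{V_1,V_2,V_3\}$.
   Context: A feasible $k$-partition of $V$ is a partition into $k$ non-empty parts each inducing a connected subgraph of $G$. Two disjoint vertex sets are adjacent if some edge joins them. For feasible $k$-partitions $\{V_1,\dots,V_k\}$ and $\{V'_1,\dots,V'_k\}$, each labelled so that part sizes are non-decreasing, $\{V'_i\}$ is better than $\{V_i\}$ if $|V'_k|<|V_k|$, or $|V'_k|=|V_k|$ and $|V'_{k-1}|<|V_{k-1}|$. -}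

module Defs where

open import Data.Nat using (ℕ; _<_; _⊔_; _⊓_)
open import Data.Fin using (Fin; zero; suc)
open import Data.Fin.Subset using (Subset; _∈_; _∉_; Nonempty; ∣_∣)
open import Data.Product using (Σ; ∃; _×_; _,_)
open import Data.Sum using (_⊎_)
open import Relation.Nullary using (¬_)
open import Relation.Binary.PropositionalEquality using (_≡_)

record Graph (n : ℕ) : Set₁ where
  field
    Adj   : Fin n → Fin n → Set
    sym   : ∀ {u v} → Adj u v → Adj v u
    irrefl : ∀ {u} → ¬ Adj u u
open Graph public

module _ {n : ℕ} (G : Graph n) where

  -- Walks from u to v all of whose vertices lie in S (walks in G[S]).
  data WalkIn (S : Subset n) : Fin n → Fin n → Set where
    here : ∀ {u} → u ∈ S → WalkIn S u u
    step : ∀ {u w v} → u ∈ S → Adj G u w → WalkIn S w v → WalkIn S u v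

  -- G[S] is connected (non-emptiness required separately where needed).
  InducedConnected : Subset n → Set
  InducedConnected S = ∀ {u v} → u ∈ S → v ∈ S → WalkIn S u v

  ConnectedGraph : Set
  ConnectedGraph = ∀ (u v : Fin n) → WalkIn Data.Fin.Subset.⊤ u v

  AdjacentSets : Subset n → Subset n → Set
  AdjacentSets A B = ∃ λ u → ∃ λ v → u ∈ A × v ∈ B × Adj G u v

  FeasibleTripartition : Subset n → Subset n → Subset n → Set
  FeasibleTripartition A B C =
    (Nonempty A × Nonempty B × Nonempty C) ×
    (∀ x → x ∈ A → x ∉ B) × (∀ x → x ∈ B → x ∉ C) × (∀ x → x ∈ A → x ∉ C) ×
    (∀ x → x ∈ A ⊎ x ∈ B ⊎ x ∈ C) ×
    (InducedConnected A × InducedConnected B × InducedConnected C)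

-- Largest and second largest of three sizes (i.e. |V_3| and |V_2| after
-- sorting the sizes in non-decreasing order).
largest3 : ℕ → ℕ → ℕ → ℕ
largest3 a b c = a ⊔ (b ⊔ c)

second3 : ℕ → ℕ → ℕ → ℕ
second3 a b c = (a ⊓ b) ⊔ ((b ⊓ c) ⊔ (a ⊓ c))

Better : ∀ {n} → (A' B' C' A B C : Subset n) → Set
Better A' B' C' A B C =
  largest3 (∣ A' ∣) (∣ B' ∣) (∣ C' ∣) < largest3 (∣ A ∣) (∣ B ∣) (∣ C ∣)
  ⊎ (largest3 (∣ A' ∣) (∣ B' ∣) (∣ C' ∣) ≡ largest3 (∣ A ∣) (∣ B ∣) (∣ C ∣)
     × second3 (∣ A' ∣) (∣ B' ∣) (∣ C' ∣) < second3 (∣ A ∣) (∣ B ∣) (∣ C ∣))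

-- selecting V_i and V_{3-i} for i ∈ {1,2} (Fin 2: zero ↦ 1, suc zero ↦ 2)
pick : ∀ {n} → Fin 2 → Subset n → Subset n → Subset n
pick zero    V₁ V₂ = V₁
pick (suc _) V₁ V₂ = V₂

other : ∀ {n} → Fin 2 → Subset n → Subset n → Subset n
other zero    V₁ V₂ = V₂
other (suc _) V₁ V₂ = V₁

module Submission where

-- The new parts are V₃ ─ U, Vᵢ ∪ U and V₃₋ᵢ.  They are still
-- pairwise disjoint and cover V because U ⊆ V₃; V₃ ─ U is non-empty because
-- U ⊂ V₃; and Vᵢ ∪ U induces a connected subgraph because it is the union of
-- two connected sets joined by an edge (walks are concatenated across it).
--
-- The largest part strictly shrinks, so the new partition is
-- better already by the first clause of Better: every new part is smaller
-- than |V₃|.  Indeed |V₃ ─ U| < |V₃| since U ⊂ V₃ and U is non-empty,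
-- |Vᵢ ∪ U| ≤ |Vᵢ| + |U| < |V₃| by hypothesis, and |V₃₋ᵢ| ≤ |V₂| < |V₃|
-- because V₂ and V₃ are disjoint while |V₃| > n/2.

open import Defs
open import Data.Nat using (ℕ; _≤_; _<_; _+_; _*_; _⊔_; z≤n; s≤s)
open import Data.Nat.Properties
  using (≤-trans; ≤-<-trans; <-≤-trans; +-monoʳ-≤; +-suc; +-identityʳ;
         +-cancelʳ-<; m≤n⊔m; ⊔-lub; m≤o∸n⇒m+n≤o)
open import Data.Fin using (Fin; zero; suc)
open import Data.Fin.Subset
  using (Subset; _⊂_; _⊆_; _─_; _∪_; ∁; Nonempty; ∣_∣; _∈_; _∉_; inside; outside)
open import Data.Fin.Subset.Properties
  using (p⊂q⇒∣p∣<∣q∣; p⊆q⇒∣p∣≤∣q∣; ∣p∣≤n; ∣p∣≤∣x∷p∣; ∣∁p∣≡n∸∣p∣; x∉p⇒x∈∁p;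
         _∈?_; p⊆p∪q; q⊆p∪q; x∈p∪q⁻; x∈p∧x∉q⇒x∈p─q; p─q⊆p)
open import Data.Vec.Base using ([]; _∷_; here; there)
open import Data.Product using (_×_; _,_)
open import Data.Sum using (_⊎_; inj₁; inj₂)
open import Relation.Nullary using (yes; no)
open import Relation.Binary.PropositionalEquality using (subst; cong)

-- An element of p ─ q is not in q (the companion of p─q⊆p).  At the head
-- position there is nothing to prove: if q contains it, p ─ q does not.
x∈p─q⇒x∉q : ∀ {n} {x : Fin n} (p q : Subset n) → x ∈ p ─ q → x ∉ q
x∈p─q⇒x∉q (_ ∷ p) (_ ∷ q) (there x∈p─q) (there x∈q) = x∈p─q⇒x∉q p q x∈p─q x∈q

∣p∪q∣≤∣p∣+∣q∣ : ∀ {n} (p q : Subset n) → ∣ p ∪ q ∣ ≤ ∣ p ∣ + ∣ q ∣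
∣p∪q∣≤∣p∣+∣q∣ [] [] = z≤n
∣p∪q∣≤∣p∣+∣q∣ (inside ∷ p) (t ∷ q) =
  s≤s (≤-trans (∣p∪q∣≤∣p∣+∣q∣ p q) (+-monoʳ-≤ ∣ p ∣ (∣p∣≤∣x∷p∣ t q)))
∣p∪q∣≤∣p∣+∣q∣ (outside ∷ p) (inside ∷ q)
  rewrite +-suc ∣ p ∣ ∣ q ∣ = s≤s (∣p∪q∣≤∣p∣+∣q∣ p q)
∣p∪q∣≤∣p∣+∣q∣ (outside ∷ p) (outside ∷ q) = ∣p∪q∣≤∣p∣+∣q∣ p q

-- Two disjoint subsets of an n-set have at most n elements together:
-- q lies in the complement of p, which has n ∸ |p| elements.
disjoint⇒∣q∣+∣p∣≤n : ∀ {n} (p q : Subset n) → (∀ x → x ∈ p → x ∉ q) →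
                     ∣ q ∣ + ∣ p ∣ ≤ n
disjoint⇒∣q∣+∣p∣≤n p q disjoint = m≤o∸n⇒m+n≤o ∣ q ∣ (∣p∣≤n p)
  (subst (∣ q ∣ ≤_) (∣∁p∣≡n∸∣p∣ p) (p⊆q⇒∣p∣≤∣q∣ q⊆∁p))
  where
  q⊆∁p : q ⊆ ∁ p
  q⊆∁p x∈q = x∉p⇒x∈∁p (λ x∈p → disjoint _ x∈p x∈q)

minority<majority : ∀ {n} (B C : Subset n) → (∀ x → x ∈ B → x ∉ C) →
                    n < 2 * ∣ C ∣ → ∣ B ∣ < ∣ C ∣
minority<majority {n} B C disjoint n<2∣C∣ =
  +-cancelʳ-< (∣ C ∣) (∣ B ∣) (∣ C ∣)
    (≤-<-trans (disjoint⇒∣q∣+∣p∣≤n C B (λ x x∈C x∈B → disjoint x x∈B x∈C))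
               (subst (n <_) (cong (∣ C ∣ +_) (+-identityʳ ∣ C ∣)) n<2∣C∣))

module _ {n : ℕ} (G : Graph n) where

  walk-mono : ∀ {S T u v} → S ⊆ T → WalkIn G S u v → WalkIn G T u v
  walk-mono S⊆T (here u∈S)       = here (S⊆T u∈S)
  walk-mono S⊆T (step u∈S e walk) = step (S⊆T u∈S) e (walk-mono S⊆T walk)

  walk-append : ∀ {S u w w' v} →
                WalkIn G S u w → Adj G w w' → WalkIn G S w' v → WalkIn G S u v
  walk-append (here u∈S)        e rest = step u∈S e rest
  walk-append (step u∈S e' walk) e rest = step u∈S e' (walk-append walk e rest)

  walk-∪ˡ : ∀ {P} Q {u v} → WalkIn G P u v → WalkIn G (P ∪ Q) u v
  walk-∪ˡ Q = walk-mono (p⊆p∪q Q)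

  walk-∪ʳ : ∀ P Q {u v} → WalkIn G Q u v → WalkIn G (P ∪ Q) u v
  walk-∪ʳ P Q = walk-mono (q⊆p∪q P Q)

  connected-∪ : ∀ {P U} → InducedConnected G P → InducedConnected G U →
                AdjacentSets G U P → InducedConnected G (P ∪ U)
  connected-∪ {P} {U} cP cU (a , b , a∈U , b∈P , ab) {y} {z} y∈ z∈
    with x∈p∪q⁻ P U y∈ | x∈p∪q⁻ P U z∈
  ... | inj₁ y∈P | inj₁ z∈P = walk-∪ˡ U (cP y∈P z∈P)
  ... | inj₂ y∈U | inj₂ z∈U = walk-∪ʳ P U (cU y∈U z∈U)
  ... | inj₁ y∈P | inj₂ z∈U =
    walk-append (walk-∪ˡ U (cP y∈P b∈P)) (sym G ab) (walk-∪ʳ P U (cU a∈U z∈U))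
  ... | inj₂ y∈U | inj₁ z∈P =
    walk-append (walk-∪ʳ P U (cU y∈U a∈U)) ab (walk-∪ˡ U (cP b∈P z∈P))

  transfer-feasible :
    ∀ {P Q V U} → FeasibleTripartition G P Q V →
    Nonempty U → U ⊂ V → InducedConnected G U → InducedConnected G (V ─ U) →
    AdjacentSets G U P → FeasibleTripartition G (V ─ U) (P ∪ U) Q
  transfer-feasible {P} {Q} {V} {U}
    ((_ , Q≠∅ , _) , P∩Q=∅ , Q∩V=∅ , P∩V=∅ , covers , (cP , cQ , _))
    (u , u∈U) (U⊆V , (x , x∈V , x∉U)) cU cV─U adjacent =
      ((x , x∈p∧x∉q⇒x∈p─q x∈V x∉U) , (u , q⊆p∪q P U u∈U) , Q≠∅)
    , disjoint₁₂ , disjoint₂₃ , disjoint₁₃ , covers′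
    , (cV─U , connected-∪ cP cU adjacent , cQ)
    where
    disjoint₁₂ : ∀ y → y ∈ V ─ U → y ∉ P ∪ U
    disjoint₁₂ y y∈V─U y∈P∪U with x∈p∪q⁻ P U y∈P∪U
    ... | inj₁ y∈P = P∩V=∅ y y∈P (p─q⊆p V U y∈V─U)
    ... | inj₂ y∈U = x∈p─q⇒x∉q V U y∈V─U y∈U
    disjoint₂₃ : ∀ y → y ∈ P ∪ U → y ∉ Q
    disjoint₂₃ y y∈P∪U y∈Q with x∈p∪q⁻ P U y∈P∪U
    ... | inj₁ y∈P = P∩Q=∅ y y∈P y∈Q
    ... | inj₂ y∈U = Q∩V=∅ y y∈Q (U⊆V y∈U)
    disjoint₁₃ : ∀ y → y ∈ V ─ U → y ∉ Q
    disjoint₁₃ y y∈V─U y∈Q = Q∩V=∅ y y∈Q (p─q⊆p V U y∈V─U)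
    covers′ : ∀ y → y ∈ V ─ U ⊎ y ∈ P ∪ U ⊎ y ∈ Q
    covers′ y with covers y
    ... | inj₁ y∈P        = inj₂ (inj₁ (p⊆p∪q U y∈P))
    ... | inj₂ (inj₁ y∈Q) = inj₂ (inj₂ y∈Q)
    ... | inj₂ (inj₂ y∈V) with y ∈? U
    ...   | yes y∈U = inj₂ (inj₁ (q⊆p∪q P U y∈U))
    ...   | no  y∉U = inj₁ (x∈p∧x∉q⇒x∈p─q y∈V y∉U)

  feasible-pick : ∀ (i : Fin 2) {V₁ V₂ V₃} → FeasibleTripartition G V₁ V₂ V₃ →
                  FeasibleTripartition G (pick i V₁ V₂) (other i V₁ V₂) V₃
  feasible-pick zero    feasible = feasible
  feasible-pick (suc _) {V₁} {V₂} {V₃}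
    ((ne₁ , ne₂ , ne₃) , d₁₂ , d₂₃ , d₁₃ , covers , (c₁ , c₂ , c₃)) =
    (ne₂ , ne₁ , ne₃) , (λ x x∈V₂ x∈V₁ → d₁₂ x x∈V₁ x∈V₂) , d₁₃ , d₂₃ , covers′ ,
    (c₂ , c₁ , c₃)
    where
    covers′ : ∀ x → x ∈ V₂ ⊎ x ∈ V₁ ⊎ x ∈ V₃
    covers′ x with covers x
    ... | inj₁ x∈V₁        = inj₂ (inj₁ x∈V₁)
    ... | inj₂ (inj₁ x∈V₂) = inj₁ x∈V₂
    ... | inj₂ (inj₂ x∈V₃) = inj₂ (inj₂ x∈V₃)

largest3< : ∀ {a b c m} → a < m → b < m → c < m → largest3 a b c < m
largest3< a<m b<m c<m = ⊔-lub a<m (⊔-lub b<m c<m)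

≤largest3 : ∀ a b c → c ≤ largest3 a b c
≤largest3 a b c = ≤-trans (m≤n⊔m b c) (m≤n⊔m a (b ⊔ c))

transfer-shrinks :
  ∀ {n} (P Q V U : Subset n) → Nonempty U → U ⊂ V →
  ∣ P ∣ + ∣ U ∣ < ∣ V ∣ → ∣ Q ∣ < ∣ V ∣ →
  largest3 (∣ V ─ U ∣) (∣ P ∪ U ∣) (∣ Q ∣) < ∣ V ∣
transfer-shrinks P Q V U (u , u∈U) (U⊆V , _) ∣P∣+∣U∣<∣V∣ ∣Q∣<∣V∣ =
  largest3< (p⊂q⇒∣p∣<∣q∣ V─U⊂V) (≤-<-trans (∣p∪q∣≤∣p∣+∣q∣ P U) ∣P∣+∣U∣<∣V∣) ∣Q∣<∣V∣
  where
  V─U⊂V : V ─ U ⊂ V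
  V─U⊂V = p─q⊆p V U , u , U⊆V u∈U , (λ u∈V─U → x∈p─q⇒x∉q V U u∈V─U u∈U)

other< : ∀ {n} (i : Fin 2) (V₁ V₂ : Subset n) {m} →
         ∣ V₁ ∣ < m → ∣ V₂ ∣ < m → ∣ other i V₁ V₂ ∣ < m
other< zero    V₁ V₂ _     ∣V₂∣<m = ∣V₂∣<m
other< (suc _) V₁ V₂ ∣V₁∣<m _     = ∣V₁∣<m

lemma3 : ∀ {n : ℕ} (G : Graph n) → ConnectedGraph G →
         (V₁ V₂ V₃ : Subset n) → FeasibleTripartition G V₁ V₂ V₃ →
         ∣ V₁ ∣ ≤ ∣ V₂ ∣ → ∣ V₂ ∣ ≤ ∣ V₃ ∣ → n < 2 * ∣ V₃ ∣ →
         (i : Fin 2) (U : Subset n) → Nonempty U → U ⊂ V₃ →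
         InducedConnected G U → InducedConnected G (V₃ ─ U) →
         AdjacentSets G U (pick i V₁ V₂) →
         ∣ pick i V₁ V₂ ∣ + ∣ U ∣ < ∣ V₃ ∣ →
         FeasibleTripartition G (V₃ ─ U) (pick i V₁ V₂ ∪ U) (other i V₁ V₂)
         × Better (V₃ ─ U) (pick i V₁ V₂ ∪ U) (other i V₁ V₂) V₁ V₂ V₃
lemma3 G _ V₁ V₂ V₃ feasible ∣V₁∣≤∣V₂∣ _ n<2∣V₃∣ i U U≠∅ U⊂V₃ cU cV₃─U adjacent small =
  transfer-feasible G (feasible-pick G i feasible) U≠∅ U⊂V₃ cU cV₃─U adjacent ,
  inj₁ (<-≤-trans
         (transfer-shrinks (pick i V₁ V₂) (other i V₁ V₂) V₃ U U≠∅ U⊂V₃ small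
                           (other< i V₁ V₂ (≤-<-trans ∣V₁∣≤∣V₂∣ ∣V₂∣<∣V₃∣) ∣V₂∣<∣V₃∣))
         (≤largest3 (∣ V₁ ∣) (∣ V₂ ∣) (∣ V₃ ∣)))
  where
  V₂∩V₃=∅ : ∀ x → x ∈ V₂ → x ∉ V₃
  V₂∩V₃=∅ = let (_ , _ , d₂₃ , _) = feasible in d₂₃
  ∣V₂∣<∣V₃∣ : ∣ V₂ ∣ < ∣ V₃ ∣
  ∣V₂∣<∣V₃∣ = minority<majority V₂ V₃ V₂∩V₃=∅ n<2∣V₃∣
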